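{- Let $k\ge 3$ be fixed. Let $f(n,k)$ be the fraction of $n$-tuples $(B_1,\dots,B_n)$ of subsets of $\{1,\dots,k\}$ (among all $2^{nk}$ such tuples) for which the collection $\{B_1,\dots,B_n\}$ is $\frac12$-splittable. Then $f(n,k)\to 0$ as $n\to\infty$.
   Context: A collection $\{B_1,\dots,B_n\}$ of finite sets is $\frac12$-splittable if there is a set $S$ with $|S\cap B_i|\in\{\lfloor |B_i|/2\rfloor,\lceil |B_i|/2\rceil\}$ for all $i$. -}

module Defs where

open import Data.Nat.Base using (ℕ; zero; suc; ⌊_/2⌋; ⌈_/2⌉)
open import Data.Nat.Properties using (_≟_)
open import Data.Bool.Base using (Bool)
open import Data.Fin.Subset using (Subset; inside; outside; _∩_; ∣_∣)
open import Data.Fin.Subset.Properties using (anySubset?)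
open import Data.Vec.Base using (Vec; []; _∷_)
open import Data.Vec.Relation.Unary.All using (All; all?)
open import Data.List.Base using (List; [_]; map; _++_; concatMap; filter; length)
open import Data.Product using (∃)
open import Data.Sum.Base using (_⊎_)
open import Relation.Binary.PropositionalEquality using (_≡_)
open import Relation.Nullary.Decidable using (Dec; _⊎-dec_)

HalfSplits : ∀ {k} → Subset k → Subset k → Set
HalfSplits S B = (∣ S ∩ B ∣ ≡ ⌊ ∣ B ∣ /2⌋) ⊎ (∣ S ∩ B ∣ ≡ ⌈ ∣ B ∣ /2⌉)

HalfSplittable : ∀ {k n} → Vec (Subset k) n → Set
HalfSplittable {k} Bs = ∃ λ (S : Subset k) → All (HalfSplits S) Bs

halfSplits? : ∀ {k} (S B : Subset k) → Dec (HalfSplits S B)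
halfSplits? S B = (∣ S ∩ B ∣ ≟ ⌊ ∣ B ∣ /2⌋) ⊎-dec (∣ S ∩ B ∣ ≟ ⌈ ∣ B ∣ /2⌉)

halfSplittable? : ∀ {k n} (Bs : Vec (Subset k) n) → Dec (HalfSplittable Bs)
halfSplittable? Bs = anySubset? (λ S → all? (halfSplits? S) Bs)

allSubsets : ∀ k → List (Subset k)
allSubsets zero = [ [] ]
allSubsets (suc k) = map (inside ∷_) (allSubsets k) ++ map (outside ∷_) (allSubsets k)

allTuples : ∀ k n → List (Vec (Subset k) n)
allTuples k zero = [ [] ]
allTuples k (suc n) = concatMap (λ B → map (B ∷_) (allTuples k n)) (allSubsets k)

-- Number of n-tuples (B₁,…,Bₙ) that are ½-splittable; f(n,k) = splittableCount k n / 2^(nk).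
splittableCount : ℕ → ℕ → ℕ
splittableCount k n = length (filter halfSplittable? (allTuples k n))

-- A two-element set lying inside S or outside S meets S in 0 or 2 points, so S does
-- not half-split it.  Of the first three points of {1,…,k} two lie on the same side
-- of S; hence every ½-splittable tuple avoids one of the pairs {1,2}, {1,3}, {2,3}
-- altogether.  Only (2^k − 1)^n tuples avoid a fixed set, so f(n,k) ≤ 3 (1 − 2^-k)^n,
-- which Bernoulli's inequality makes eventually smaller than any 1/m.
module Submission where

open import Defs
open import Data.Nat.Base using (ℕ; _*_; _^_; _≤_; _<_)
open import Data.Product using (∃)

open import Data.Bool.Base using (Bool; true; false)
import Data.Bool.Properties as Bool
open import Data.Fin.Subset using (Subset; inside; outside; _∩_; ∣_∣; ⊥)
open import Data.Fin.Subset.Properties using (∣⊥∣≡0; ∩-zeroʳ)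
open import Data.List.Base using (List; []; _∷_; [_]; map; _++_; concatMap; filter; length)
open import Data.List.Membership.Propositional using (_∈_; find; lose)
open import Data.List.Membership.Propositional.Properties using (∈-map⁺; ∈-++⁺ˡ; ∈-++⁺ʳ)
open import Data.List.Properties
  using (length-++; length-map; filter-++; filter-accept; filter-none; filter-notAll; filter-≐)
import Data.List.Relation.Unary.All as ListAll
open import Data.List.Relation.Unary.Any as Any using (Any; here; there; any?)
open import Data.Nat.Base using (zero; suc; _+_; pred; z≤n; s≤s; NonZero; >-nonZero; ⌊_/2⌋; ⌈_/2⌉)
open import Data.Nat.Properties
open import Data.Nat.Tactic.RingSolver using (solve-∀)
open import Data.Product using (_,_)
open import Data.Sum.Base using (_⊎_; inj₁; inj₂)
import Data.Sum.Base as Sum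
open import Data.Vec.Base using (Vec; []; _∷_)
open import Data.Vec.Properties using (≡-dec)
open import Data.Vec.Relation.Unary.All as All using (All; all?; []; _∷_)
open import Function.Base using (_∘_; id)
open import Level using (Level)
open import Relation.Binary.Definitions using (DecidableEquality)
open import Relation.Binary.PropositionalEquality
  using (_≡_; _≢_; refl; sym; trans; cong; cong₂; subst; module ≡-Reasoning)
open import Relation.Nullary using (¬_; Dec; yes; no; ¬?; does)
open import Relation.Unary using (Pred; Decidable)

private variable
  a p q r : Level
  X : Set a

count : {P : Pred X p} → Decidable P → List X → ℕ
count P? = length ∘ filter P?

module _ {P : Pred X p} (P? : Decidable P) where

  count-++ : ∀ xs ys → count P? (xs ++ ys) ≡ count P? xs + count P? ys
  count-++ xs ys = trans (cong length (filter-++ P? xs ys)) (length-++ (filter P? xs))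

  count-none : ∀ xs → (∀ x → ¬ P x) → count P? xs ≡ 0
  count-none xs ¬P = cong length (filter-none P? (ListAll.universal ¬P xs))

  count-map : ∀ {b} {B : Set b} (f : B → X) xs → count P? (map f xs) ≡ count (P? ∘ f) xs
  count-map f [] = refl
  count-map f (x ∷ xs) with does (P? (f x))
  ... | true  = cong suc (count-map f xs)
  ... | false = count-map f xs

  count-≤-∷ : ∀ x xs → count P? xs ≤ count P? (x ∷ xs)
  count-≤-∷ x xs with does (P? x)
  ... | true  = n≤1+n _
  ... | false = ≤-refl

module _ {R : Pred X r} {P : Pred X p} {Q : Pred X q}
         (R? : Decidable R) (P? : Decidable P) (Q? : Decidable Q) where

  count-∪ : (∀ {x} → R x → P x ⊎ Q x) → ∀ xs → count R? xs ≤ count P? xs + count Q? xs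
  count-∪ R⊆P∪Q [] = z≤n
  count-∪ R⊆P∪Q (x ∷ xs) with R? x
  ... | no _ = ≤-trans (count-∪ R⊆P∪Q xs) (+-mono-≤ (count-≤-∷ P? x xs) (count-≤-∷ Q? x xs))
  ... | yes Rx with R⊆P∪Q Rx
  ...   | inj₁ Px rewrite filter-accept P? {xs = xs} Px =
    s≤s (≤-trans (count-∪ R⊆P∪Q xs) (+-monoʳ-≤ _ (count-≤-∷ Q? x xs)))
  ...   | inj₂ Qx rewrite filter-accept Q? {xs = xs} Qx | +-suc (count P? (x ∷ xs)) (count Q? xs) =
    s≤s (≤-trans (count-∪ R⊆P∪Q xs) (+-monoˡ-≤ _ (count-≤-∷ P? x xs)))

count-⋃ : ∀ {i} {I : Set i} {R : Pred X r} {Q : I → Pred X q}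
          (R? : Decidable R) (Q? : ∀ j → Decidable (Q j)) (js : List I) →
          (∀ {x} → R x → Any (λ j → Q j x) js) →
          ∀ {c} xs → (∀ j → count (Q? j) xs ≤ c) → count R? xs ≤ length js * c
count-⋃ R? Q? [] R⊆⋃ xs _ = ≤-reflexive (count-none R? xs (λ _ → (λ ()) ∘ R⊆⋃))
count-⋃ R? Q? (j ∷ js) R⊆⋃ xs bound =
  ≤-trans (count-∪ R? (Q? j) ⋃js? (Any.toSum ∘ R⊆⋃) xs)
          (+-mono-≤ (bound j) (count-⋃ ⋃js? Q? js id xs bound))
  where ⋃js? = λ x → any? (λ j → Q? j x) js

module _ {k} {P : Pred (Subset k) p} (P? : Decidable P) where

  count-all-map-accept : ∀ {n B} (Ts : List (Vec (Subset k) n)) → P B →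
                    count (all? P?) (map (B ∷_) Ts) ≡ count (all? P?) Ts
  count-all-map-accept {B = B} Ts PB = begin
    count (all? P?) (map (B ∷_) Ts)        ≡⟨ count-map (all? P?) (B ∷_) Ts ⟩
    count (all? P? ∘ (B ∷_)) Ts            ≡⟨ cong length (filter-≐ _ (all? P?) (All.tail , PB ∷_) Ts) ⟩
    count (all? P?) Ts                     ∎
    where open ≡-Reasoning

  count-all-map-reject : ∀ {n B} (Ts : List (Vec (Subset k) n)) → ¬ P B →
                       count (all? P?) (map (B ∷_) Ts) ≡ 0
  count-all-map-reject {B = B} Ts ¬PB = trans (count-map (all? P?) (B ∷_) Ts)
    (count-none (all? P? ∘ (B ∷_)) Ts (λ { _ (PB ∷ _) → ¬PB PB }))

  count-all-map-∷ : ∀ {n} B (Ts : List (Vec (Subset k) n)) →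
                    count (all? P?) (map (B ∷_) Ts) ≡ count P? [ B ] * count (all? P?) Ts
  count-all-map-∷ B Ts with P? B
  ... | yes PB = trans (count-all-map-accept Ts PB) (sym (*-identityˡ _))
  ... | no ¬PB = count-all-map-reject Ts ¬PB

  count-all-concatMap : ∀ {n} (Bs : List (Subset k)) (Ts : List (Vec (Subset k) n)) →
                        count (all? P?) (concatMap (λ B → map (B ∷_) Ts) Bs) ≡ count P? Bs * count (all? P?) Ts
  count-all-concatMap [] Ts = refl
  count-all-concatMap (B ∷ Bs) Ts = begin
    count (all? P?) (map (B ∷_) Ts ++ rest)                 ≡⟨ count-++ (all? P?) (map (B ∷_) Ts) rest ⟩
    count (all? P?) (map (B ∷_) Ts) + count (all? P?) rest  ≡⟨ cong₂ _+_ (count-all-map-∷ B Ts) (count-all-concatMap Bs Ts) ⟩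
    count P? [ B ] * t + count P? Bs * t                    ≡⟨ sym (*-distribʳ-+ t (count P? [ B ]) (count P? Bs)) ⟩
    (count P? [ B ] + count P? Bs) * t                      ≡⟨ cong (_* t) (sym (count-++ P? [ B ] Bs)) ⟩
    count P? (B ∷ Bs) * t                                   ∎
    where open ≡-Reasoning
          rest = concatMap (λ B → map (B ∷_) Ts) Bs
          t = count (all? P?) Ts

  count-all-allTuples : ∀ n → count (all? P?) (allTuples k n) ≡ count P? (allSubsets k) ^ n
  count-all-allTuples zero = refl
  count-all-allTuples (suc n) = begin
    count (all? P?) (allTuples k (suc n))                        ≡⟨ count-all-concatMap (allSubsets k) (allTuples k n) ⟩
    count P? (allSubsets k) * count (all? P?) (allTuples k n)    ≡⟨ cong (count P? (allSubsets k) *_) (count-all-allTuples n) ⟩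
    count P? (allSubsets k) ^ suc n                              ∎
    where open ≡-Reasoning

length-allSubsets : ∀ k → length (allSubsets k) ≡ 2 ^ k
length-allSubsets zero = refl
length-allSubsets (suc k) = begin
  length (map (inside ∷_) Bs ++ map (outside ∷_) Bs)     ≡⟨ length-++ (map (inside ∷_) Bs) ⟩
  length (map (inside ∷_) Bs) + length (map (outside ∷_) Bs)
      ≡⟨ cong₂ _+_ (length-map (inside ∷_) Bs) (length-map (outside ∷_) Bs) ⟩
  length Bs + length Bs                                   ≡⟨ cong (λ l → l + l) (length-allSubsets k) ⟩
  2 ^ k + 2 ^ k                                           ≡⟨ cong (2 ^ k +_) (sym (+-identityʳ (2 ^ k))) ⟩
  2 ^ suc k                                               ∎
  where open ≡-Reasoning
        Bs = allSubsets k

∈-allSubsets : ∀ {k} (B : Subset k) → B ∈ allSubsets k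
∈-allSubsets [] = here refl
∈-allSubsets (inside ∷ B) = ∈-++⁺ˡ (∈-map⁺ (inside ∷_) (∈-allSubsets B))
∈-allSubsets {suc k} (outside ∷ B) = ∈-++⁺ʳ (map (inside ∷_) (allSubsets k)) (∈-map⁺ (outside ∷_) (∈-allSubsets B))

_≟ₛ_ : ∀ {k} → DecidableEquality (Subset k)
_≟ₛ_ = ≡-dec Bool._≟_

_≢?_ : ∀ {k} (C B : Subset k) → Dec (C ≢ B)
C ≢? B = ¬? (C ≟ₛ B)

count-≢-allSubsets : ∀ {k} (B : Subset k) → count (_≢? B) (allSubsets k) ≤ pred (2 ^ k)
count-≢-allSubsets {k} B = <⇒≤pred (subst (count (_≢? B) (allSubsets k) <_) (length-allSubsets k)
  (filter-notAll (_≢? B) (allSubsets k) (Any.map (λ B≡C C≢B → C≢B (sym B≡C)) (∈-allSubsets B))))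

count-avoiding : ∀ k n (B : Subset k) → count (all? (_≢? B)) (allTuples k n) ≤ pred (2 ^ k) ^ n
count-avoiding k n B = begin
  count (all? (_≢? B)) (allTuples k n)  ≡⟨ count-all-allTuples (_≢? B) n ⟩
  count (_≢? B) (allSubsets k) ^ n      ≤⟨ ^-monoˡ-≤ n (count-≢-allSubsets B) ⟩
  pred (2 ^ k) ^ n                      ∎
  where open ≤-Reasoning

Monochromatic : ∀ {k} → Subset k → Subset k → Set
Monochromatic S B = S ∩ B ≡ ⊥ ⊎ S ∩ B ≡ B

extremes-not-half : ∀ {x} n → 2 ≤ n → x ≡ 0 ⊎ x ≡ n → ¬ (x ≡ ⌊ n /2⌋ ⊎ x ≡ ⌈ n /2⌉)
extremes-not-half (suc (suc n)) (s≤s (s≤s z≤n)) (inj₁ refl) (inj₁ x≡⌊n/2⌋) = 0≢1+n x≡⌊n/2⌋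
extremes-not-half (suc (suc n)) (s≤s (s≤s z≤n)) (inj₁ refl) (inj₂ x≡⌈n/2⌉) = 0≢1+n x≡⌈n/2⌉
extremes-not-half (suc (suc n)) (s≤s (s≤s z≤n)) (inj₂ refl) (inj₁ x≡⌊n/2⌋) = <⇒≢ (⌊n/2⌋<n (suc n)) (sym x≡⌊n/2⌋)
extremes-not-half (suc (suc n)) (s≤s (s≤s z≤n)) (inj₂ refl) (inj₂ x≡⌈n/2⌉) = <⇒≢ (⌈n/2⌉<n n) (sym x≡⌈n/2⌉)

monochromatic⇒¬HalfSplits : ∀ {k} {S B : Subset k} → 2 ≤ ∣ B ∣ → Monochromatic S B → ¬ HalfSplits S B
monochromatic⇒¬HalfSplits {k} {B = B} 2≤∣B∣ mono =
  extremes-not-half ∣ B ∣ 2≤∣B∣ (Sum.map (λ e → trans (cong ∣_∣ e) (∣⊥∣≡0 k)) (cong ∣_∣) mono)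

module _ {k : ℕ} where

  pair₀₁ pair₀₂ pair₁₂ : Subset (3 + k)
  pair₀₁ = inside  ∷ inside  ∷ outside ∷ ⊥
  pair₀₂ = inside  ∷ outside ∷ inside  ∷ ⊥
  pair₁₂ = outside ∷ inside  ∷ inside  ∷ ⊥

  pairs : List (Subset (3 + k))
  pairs = pair₀₁ ∷ pair₀₂ ∷ pair₁₂ ∷ []

  2≤∣pair∣ : ∀ {p} → p ∈ pairs → 2 ≤ ∣ p ∣
  2≤∣pair∣ (here refl)                 = s≤s (s≤s z≤n)
  2≤∣pair∣ (there (here refl))         = s≤s (s≤s z≤n)
  2≤∣pair∣ (there (there (here refl))) = s≤s (s≤s z≤n)

  ∩⊥-under-prefix : ∀ {x y z : Bool} (r : Subset k) →
                    _≡_ {A = Subset (3 + k)} (x ∷ y ∷ z ∷ (r ∩ ⊥)) (x ∷ y ∷ z ∷ ⊥)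
  ∩⊥-under-prefix {x} {y} {z} r = cong (λ s → x ∷ y ∷ z ∷ s) (∩-zeroʳ r)

  monochromaticPair : (S : Subset (3 + k)) → Any (Monochromatic S) pairs
  monochromaticPair (inside  ∷ inside  ∷ inside  ∷ r) = here (inj₂ (∩⊥-under-prefix r))
  monochromaticPair (inside  ∷ inside  ∷ outside ∷ r) = here (inj₂ (∩⊥-under-prefix r))
  monochromaticPair (outside ∷ outside ∷ inside  ∷ r) = here (inj₁ (∩⊥-under-prefix r))
  monochromaticPair (outside ∷ outside ∷ outside ∷ r) = here (inj₁ (∩⊥-under-prefix r))
  monochromaticPair (inside  ∷ outside ∷ inside  ∷ r) = there (here (inj₂ (∩⊥-under-prefix r)))
  monochromaticPair (outside ∷ inside  ∷ outside ∷ r) = there (here (inj₁ (∩⊥-under-prefix r)))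
  monochromaticPair (inside  ∷ outside ∷ outside ∷ r) = there (there (here (inj₁ (∩⊥-under-prefix r))))
  monochromaticPair (outside ∷ inside  ∷ inside  ∷ r) = there (there (here (inj₂ (∩⊥-under-prefix r))))

  halfSplittable⇒avoidsPair : ∀ {n} {Bs : Vec (Subset (3 + k)) n} →
                              HalfSplittable Bs → Any (λ p → All (_≢ p) Bs) pairs
  halfSplittable⇒avoidsPair (S , splitsAll) with find (monochromaticPair S)
  ... | p , p∈pairs , mono = lose p∈pairs (All.map avoids splitsAll)
    where
    avoids : ∀ {B} → HalfSplits S B → B ≢ p
    avoids splits refl = monochromatic⇒¬HalfSplits (2≤∣pair∣ p∈pairs) mono splits

  splittableCount≤ : ∀ n → splittableCount (3 + k) n ≤ 3 * pred (2 ^ (3 + k)) ^ n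
  splittableCount≤ n = count-⋃ halfSplittable? (λ p → all? (_≢? p)) pairs halfSplittable⇒avoidsPair
                         (allTuples (3 + k) n) (count-avoiding (3 + k) n)

bernoulli : ∀ a n → a ^ n * (a + n) ≤ suc a ^ n * a
bernoulli a zero = ≤-reflexive (cong (_+ 0) (+-identityʳ a))
bernoulli a (suc n) = begin
  a * a ^ n * (a + suc n)                ≡⟨ expand a n (a ^ n) ⟩
  a * (a ^ n * (a + n)) + a ^ n * a      ≤⟨ +-mono-≤ (*-monoʳ-≤ a (bernoulli a n)) (≤-trans (*-monoʳ-≤ (a ^ n) (m≤m+n a n)) (bernoulli a n)) ⟩
  a * (suc a ^ n * a) + suc a ^ n * a    ≡⟨ collect a (suc a ^ n) ⟩
  suc a * suc a ^ n * a                  ∎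
  where
  open ≤-Reasoning
  expand : ∀ a n x → a * x * (a + suc n) ≡ a * (x * (a + n)) + x * a
  expand = solve-∀
  collect : ∀ a y → a * (y * a) + y * a ≡ suc a * y * a
  collect = solve-∀

^-dominates : ∀ a .{{_ : NonZero a}} c n → c * a ≤ n → c * a ^ n < suc a ^ n
^-dominates a c n ca≤n = begin-strict
  c * a ^ n          <⟨ m<n+m (c * a ^ n) (m^n>0 a n) ⟩
  a ^ n + c * a ^ n  ≡⟨ factor (a ^ n) c ⟩
  a ^ n * suc c      ≤⟨ *-cancelˡ-≤ a scaled ⟩
  suc a ^ n          ∎
  where
  open ≤-Reasoning
  factor : ∀ x c → x + c * x ≡ x * suc c
  factor = solve-∀
  spread : ∀ a x c → a * (x * suc c) ≡ x * (a + c * a)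
  spread = solve-∀
  scaled : a * (a ^ n * suc c) ≤ a * suc a ^ n
  scaled = begin
    a * (a ^ n * suc c)    ≡⟨ spread a (a ^ n) c ⟩
    a ^ n * (a + c * a)    ≤⟨ *-monoʳ-≤ (a ^ n) (+-monoʳ-≤ a ca≤n) ⟩
    a ^ n * (a + n)        ≤⟨ bernoulli a n ⟩
    suc a ^ n * a          ≡⟨ *-comm (suc a ^ n) a ⟩
    a * suc a ^ n          ∎

proposition4p5 : (k : ℕ) → 3 ≤ k →
    (m : ℕ) → ∃ λ (N : ℕ) → (n : ℕ) → N ≤ n →
      m * splittableCount k n < 2 ^ (n * k)
proposition4p5 (suc (suc (suc k))) (s≤s (s≤s (s≤s z≤n))) m = m * 3 * A , bound
  where
  K = 3 + k
  A = pred (2 ^ K)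
  instance
    _ : NonZero A
    _ = >-nonZero (suc[m]≤n⇒m≤pred[n] (*-monoʳ-≤ 2 (m^n>0 2 (2 + k))))
  bound : ∀ n → m * 3 * A ≤ n → m * splittableCount K n < 2 ^ (n * K)
  bound n N≤n = begin-strict
    m * splittableCount K n  ≤⟨ *-monoʳ-≤ m (splittableCount≤ n) ⟩
    m * (3 * A ^ n)          ≡⟨ sym (*-assoc m 3 (A ^ n)) ⟩
    m * 3 * A ^ n            <⟨ ^-dominates A (m * 3) n N≤n ⟩
    suc A ^ n                ≡⟨ cong (_^ n) (suc-pred (2 ^ K) {{m^n≢0 2 K}}) ⟩
    (2 ^ K) ^ n              ≡⟨ ^-*-assoc 2 K n ⟩
    2 ^ (K * n)              ≡⟨ cong (2 ^_) (*-comm K n) ⟩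
    2 ^ (n * K)              ∎
    where open ≤-Reasoning
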